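{- Let $G$ and $H$ be finite digraphs with $|G|=|H|=n\geq 2$ and $G\not\cong H$. Then $\forall$ has a winning strategy in the Seurat game $\mathbf{G}^{\lceil\log_2 n\rceil}(G,H)$.
   Context: Digraphs: finite vertex set with edge relation (loops allowed, no multiple edges); $|G|$ is the number of vertices. Seurat game $\mathbf{G}^k(G,H)$: two players $\forall,\exists$, a set $\mathbf{Col}$ of $k$ colours. A position is a pair of functions $g:\mathbf{Col}\to\wp(G)$, $h:\mathbf{Col}\to\wp(H)$, initially all empty. In each of $\omega$ rounds $\forall$ chooses a colour $c$, one of the graphs and a subset of its vertices; $\exists$ then chooses a subset of the other graph; $c$ is then assigned these two sets (erasing its previous use). The palette of a vertex is the set of colours whose set contains it; $P^G$ is the set of vertices of $G$ with palette exactly $P$. $\forall$ wins in round $n$ if at its beginning (C1) some palette $P$ has $P^G$ empty and $P^H$ nonempty or vice versa, or (C2) there are palettes $P_1,P_2$ with an edge from $P_1^G$ to $P_2^G$ but none from $P_1^H$ to $P_2^H$, or vice versa. $\forall$ has a winning strategy if he can guarantee a win in finitely many rounds. -}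

module Defs where

open import Data.Nat using (ℕ)
open import Data.Fin using (Fin; _≟_)
open import Data.Bool using (Bool; true; false)
open import Data.Product using (Σ; ∃; _×_; _,_)
open import Data.Sum using (_⊎_)
open import Relation.Nullary using (¬_; yes; no)
open import Relation.Binary.PropositionalEquality using (_≡_)
open import Function.Bundles using (_↔_; Inverse)

-- A finite digraph on n vertices (vertex set Fin n): an edge relation given
-- as a Boolean adjacency matrix (loops allowed, no multiple edges).
Digraph : ℕ → Set
Digraph n = Fin n → Fin n → Bool

_≅_ : {n : ℕ} → Digraph n → Digraph n → Set
_≅_ {n} G H = Σ (Fin n ↔ Fin n) λ f →
  ∀ u v → G u v ≡ H (Inverse.to f u) (Inverse.to f v)

VSet : ℕ → Set
VSet n = Fin n → Bool

Colouring : ℕ → ℕ → Set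
Colouring k n = Fin k → VSet n

Palette : ℕ → Set
Palette k = Fin k → Bool

-- v ∈ P^G : the palette of v (colours whose set contains v) is exactly P.
HasPalette : {k n : ℕ} → Colouring k n → Palette k → Fin n → Set
HasPalette g P v = ∀ c → g c v ≡ P c

PalNonempty : {k n : ℕ} → Colouring k n → Palette k → Set
PalNonempty g P = ∃ λ v → HasPalette g P v

PalEdge : {k n : ℕ} → Digraph n → Colouring k n → Palette k → Palette k → Set
PalEdge G g P₁ P₂ = ∃ λ u → ∃ λ v →
  HasPalette g P₁ u × HasPalette g P₂ v × G u v ≡ true

C1 : {k n : ℕ} → Colouring k n → Colouring k n → Set
C1 {k} g h = ∃ λ (P : Palette k) →
  (¬ PalNonempty g P × PalNonempty h P) ⊎ (PalNonempty g P × ¬ PalNonempty h P)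

C2 : {k n : ℕ} → Digraph n → Digraph n → Colouring k n → Colouring k n → Set
C2 {k} G H g h = ∃ λ (P₁ : Palette k) → ∃ λ (P₂ : Palette k) →
  (PalEdge G g P₁ P₂ × ¬ PalEdge H h P₁ P₂) ⊎ (¬ PalEdge G g P₁ P₂ × PalEdge H h P₁ P₂)

update : {k n : ℕ} → Colouring k n → Fin k → VSet n → Colouring k n
update g c S c' with c ≟ c'
... | yes _ = S
... | no  _ = g c'

empty : {k n : ℕ} → Colouring k n
empty _ _ = false

-- ForallWins G H g h : from position (g , h) (at the beginning of a round),
-- ∀ has a strategy guaranteeing a win in finitely many rounds.
data ForallWins {k n : ℕ} (G H : Digraph n) : Colouring k n → Colouring k n → Set where
  win-C1 : ∀ {g h} → C1 g h → ForallWins G H g h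
  win-C2 : ∀ {g h} → C2 G H g h → ForallWins G H g h
  play-G : ∀ {g h} (c : Fin k) (S : VSet n) →
           (∀ (T : VSet n) → ForallWins G H (update g c S) (update h c T)) →
           ForallWins G H g h
  play-H : ∀ {g h} (c : Fin k) (S : VSet n) →
           (∀ (T : VSet n) → ForallWins G H (update g c T) (update h c S)) →
           ForallWins G H g h

ForallWinsGame : {n : ℕ} → ℕ → Digraph n → Digraph n → Set
ForallWinsGame k G H = ForallWins {k} G H empty empty

-- ∀ spends the ⌈log₂ n⌉ rounds colouring G so that the vertices of G get
-- pairwise distinct palettes (colour c marks the vertices whose c-th binary
-- digit is 1). Whatever ∃ answered, if (C1) fails then every palette of G
-- occurs in H, so sending each vertex of G to a vertex of H with the same
-- palette is an injection, hence a bijection, of the n vertices. As G ≇ H it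
-- mismatches some edge, and the palettes of the endpoints witness (C2).
module Submission where

open import Defs
open import Data.Nat using (ℕ; _≤_)
open import Data.Nat.Logarithm using (⌈log₂_⌉)
open import Relation.Nullary using (¬_)

open import Data.Nat using (zero; suc; _+_; _*_; _^_; _<_; z≤n; s≤s; ⌈_/2⌉)
open import Data.Nat.Properties using (*-suc; *-monoʳ-≤; ⌈n/2⌉<n; n<1+n; module ≤-Reasoning)
open import Data.Nat.Induction using (<-wellFounded)
open import Data.Nat.Logarithm.Core using (⌈log2⌉)
open import Induction.WellFounded using (Acc; acc)
open import Data.Fin using (Fin; zero; suc; inject≤; finToFun; funToFin; combine; punchOut; _≟_)
open import Data.Fin.Properties
  using (2↔Bool; inject≤-injective; funToFin-finToFin; punchOut-injective; <⇒notInjective; any?; all?; ¬∀⟶∃¬)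
open import Data.Bool using (true; false)
import Data.Bool.Properties as Bool
open import Data.List using ([]; _∷_; allFin)
open import Data.List.Membership.Propositional using (_∉_)
open import Data.List.Membership.Propositional.Properties using (∈-allFin)
open import Data.List.Relation.Unary.Any using (here; there)
open import Data.Product using (Σ; _,_; proj₁; proj₂)
open import Data.Sum using (_⊎_; inj₁; inj₂; [_,_]′)
open import Function using (_∘_)
open import Function.Bundles using (_↔_; Injection; mk↔ₛ′)
open import Function.Definitions using (Injective; StrictlySurjective)
open import Function.Properties.Inverse using (↔⇒↣)
open import Relation.Nullary using (yes; no; Dec; contradiction)
open import Relation.Binary.PropositionalEquality
  using (_≡_; _≢_; _≗_; refl; sym; trans; cong; cong₂; module ≡-Reasoning)

n≤2*⌈n/2⌉ : ∀ n → n ≤ 2 * ⌈ n /2⌉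
n≤2*⌈n/2⌉ zero = z≤n
n≤2*⌈n/2⌉ (suc zero) = s≤s z≤n
n≤2*⌈n/2⌉ (suc (suc n)) = begin
  suc (suc n)           ≤⟨ s≤s (s≤s (n≤2*⌈n/2⌉ n)) ⟩
  2 + 2 * ⌈ n /2⌉       ≡⟨ *-suc 2 ⌈ n /2⌉ ⟨
  2 * suc ⌈ n /2⌉       ∎
  where open ≤-Reasoning

n≤2^⌈log2⌉n : ∀ n (rec : Acc _<_ n) → n ≤ 2 ^ ⌈log2⌉ n rec
n≤2^⌈log2⌉n zero _ = z≤n
n≤2^⌈log2⌉n (suc zero) _ = s≤s z≤n
n≤2^⌈log2⌉n (suc (suc n)) (acc rs) = begin
  suc (suc n)                      ≤⟨ n≤2*⌈n/2⌉ (suc (suc n)) ⟩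
  2 * suc ⌈ n /2⌉                  ≤⟨ *-monoʳ-≤ 2 (n≤2^⌈log2⌉n (suc ⌈ n /2⌉) (rs (⌈n/2⌉<n n))) ⟩
  2 ^ ⌈log2⌉ (suc (suc n)) (acc rs) ∎
  where open ≤-Reasoning

n≤2^⌈log₂n⌉ : ∀ n → n ≤ 2 ^ ⌈log₂ n ⌉
n≤2^⌈log₂n⌉ n = n≤2^⌈log2⌉n n (<-wellFounded n)

funToFin-cong : ∀ {m n} {f g : Fin m → Fin n} → f ≗ g → funToFin f ≡ funToFin g
funToFin-cong {zero} _ = refl
funToFin-cong {suc m} f≗g = cong₂ combine (f≗g zero) (funToFin-cong (f≗g ∘ suc))

finToFun-injective : ∀ {m n} {i j : Fin (m ^ n)} → finToFun {m} {n} i ≗ finToFun j → i ≡ j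
finToFun-injective {m} {n} {i} {j} eq = begin
  i                                  ≡⟨ funToFin-finToFin {n} {m} i ⟨
  funToFin {n} {m} (finToFun {m} i)  ≡⟨ funToFin-cong eq ⟩
  funToFin {n} {m} (finToFun {m} j)  ≡⟨ funToFin-finToFin {n} {m} j ⟩
  j                                  ∎
  where open ≡-Reasoning

injective⇒strictlySurjective : ∀ {n} {f : Fin n → Fin n} →
  Injective _≡_ _≡_ f → StrictlySurjective _≡_ f
injective⇒strictlySurjective {suc n} {f} inj y with any? (λ x → f x ≟ y)
... | yes hit = hit
... | no miss = contradiction (λ {x} {x′} → squeezed {x} {x′}) (<⇒notInjective (n<1+n n))
  where
  f≢y : ∀ x → y ≢ f x
  f≢y x y≡fx = miss (x , sym y≡fx)

  squeezed : Injective _≡_ _≡_ (λ x → punchOut (f≢y x))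
  squeezed eq = inj (punchOut-injective (f≢y _) (f≢y _) eq)

injective⇒↔ : ∀ {n} (f : Fin n → Fin n) → Injective _≡_ _≡_ f → Fin n ↔ Fin n
injective⇒↔ f inj = mk↔ₛ′ f (proj₁ ∘ surj) (proj₂ ∘ surj) (λ x → inj (proj₂ (surj (f x))))
  where surj = injective⇒strictlySurjective inj

module _ {k n : ℕ} where

  palette : Colouring k n → Fin n → Palette k
  palette g v c = g c v

  hasOwnPalette : ∀ (g : Colouring k n) v → HasPalette g (palette g v) v
  hasOwnPalette g v c = refl

  hasPalette? : ∀ (g : Colouring k n) P v → Dec (HasPalette g P v)
  hasPalette? g P v = all? (λ c → g c v Bool.≟ P c)

  Separating : Colouring k n → Set
  Separating g = ∀ {u v} → (∀ c → g c u ≡ g c v) → u ≡ v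

  separating-resp-≗ : ∀ {g g′ : Colouring k n} → (∀ c → g c ≗ g′ c) → Separating g → Separating g′
  separating-resp-≗ g≗g′ sep {u} {v} eq =
    sep (λ c → trans (g≗g′ c u) (trans (eq c) (sym (g≗g′ c v))))

  hasPalette-unique : ∀ {g : Colouring k n} {P u v} →
    Separating g → HasPalette g P u → HasPalette g P v → u ≡ v
  hasPalette-unique sep hu hv = sep (λ c → trans (hu c) (sym (hv c)))

  palEdge⇒edge : ∀ {G : Digraph n} {g P Q u v} → Separating g →
    HasPalette g P u → HasPalette g Q v → PalEdge G g P Q → G u v ≡ true
  palEdge⇒edge sep hu hv (a , b , ha , hb , e)
    with refl ← hasPalette-unique sep ha hu | refl ← hasPalette-unique sep hb hv = e

  binaryColouring : n ≤ 2 ^ k → Colouring k n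
  binaryColouring n≤2^k c v = Injection.to (↔⇒↣ 2↔Bool) (finToFun (inject≤ v n≤2^k) c)

  binaryColouring-separating : (n≤2^k : n ≤ 2 ^ k) → Separating (binaryColouring n≤2^k)
  binaryColouring-separating n≤2^k eq =
    inject≤-injective n≤2^k n≤2^k _ _ (finToFun-injective (Injection.injective (↔⇒↣ 2↔Bool) ∘ eq))

  Matching : Colouring k n → Colouring k n → (Fin n → Fin n) → Set
  Matching g h f = ∀ u → HasPalette h (palette g u) (f u)

  C1⊎matching : ∀ (g h : Colouring k n) → C1 g h ⊎ Σ (Fin n → Fin n) (Matching g h)
  C1⊎matching g h with all? (λ u → any? (hasPalette? h (palette g u)))
  ... | yes matched = inj₂ (proj₁ ∘ matched , proj₂ ∘ matched)
  ... | no ¬matched with u , ¬hu ← ¬∀⟶∃¬ n _ (λ u → any? (hasPalette? h (palette g u))) ¬matched =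
    inj₁ (palette g u , inj₂ ((u , hasOwnPalette g u) , ¬hu))

  module _ {g h : Colouring k n} {f : Fin n → Fin n} (sep : Separating g) (match : Matching g h f) where

    matching-injective : Injective _≡_ _≡_ f
    matching-injective {u} {v} fu≡fv =
      sep (λ c → trans (sym (match u c)) (trans (cong (h c) fu≡fv) (match v c)))

    matching-separating : Separating h
    matching-separating {a} {b} eq
      with u , refl ← injective⇒strictlySurjective matching-injective a
         | v , refl ← injective⇒strictlySurjective matching-injective b =
      cong f (sep (λ c → trans (sym (match u c)) (trans (eq c) (match v c))))

    edge-mismatch⇒C2 : ∀ {G H : Digraph n} {u v} → G u v ≢ H (f u) (f v) → C2 G H g h
    edge-mismatch⇒C2 {G} {H} {u} {v} ne with G u v in eG | H (f u) (f v) in eH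
    ... | true | true = contradiction refl ne
    ... | false | false = contradiction refl ne
    ... | true | false =
      palette g u , palette g v , inj₁ ((u , v , hasOwnPalette g u , hasOwnPalette g v , eG) , ¬H)
      where
      ¬H : ¬ PalEdge H h (palette g u) (palette g v)
      ¬H e with () ← trans (sym eH) (palEdge⇒edge matching-separating (match u) (match v) e)
    ... | false | true =
      palette g u , palette g v , inj₂ (¬G , (f u , f v , match u , match v , eH))
      where
      ¬G : ¬ PalEdge G g (palette g u) (palette g v)
      ¬G e with () ← trans (sym eG) (palEdge⇒edge sep (hasOwnPalette g u) (hasOwnPalette g v) e)

  separating⇒C1⊎C2 : ∀ {G H : Digraph n} {g h : Colouring k n} →
    ¬ (G ≅ H) → Separating g → C1 g h ⊎ C2 G H g h
  separating⇒C1⊎C2 {G} {H} {g} {h} G≇H sep with C1⊎matching g h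
  ... | inj₁ c1 = inj₁ c1
  ... | inj₂ (f , match) with all? (λ u → all? (λ v → G u v Bool.≟ H (f u) (f v)))
  ... | yes preserves =
    contradiction (injective⇒↔ f (matching-injective {h = h} sep match) , preserves) G≇H
  ... | no ¬preserves
    with u , ¬pu ← ¬∀⟶∃¬ n _ (λ u → all? (λ v → G u v Bool.≟ H (f u) (f v))) ¬preserves
    with v , ne ← ¬∀⟶∃¬ n _ (λ v → G u v Bool.≟ H (f u) (f v)) ¬pu =
    inj₂ (edge-mismatch⇒C2 {h = h} sep match ne)

  module _ {G H : Digraph n} (E : Colouring k n)
    (win : ∀ {g h} → (∀ c → g c ≗ E c) → ForallWins G H g h) where

    update-agrees : ∀ {g : Colouring k n} {c cs} → (∀ c′ → c′ ∉ c ∷ cs → g c′ ≗ E c′) →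
      ∀ c′ → c′ ∉ cs → update g c (E c) c′ ≗ E c′
    update-agrees {c = c} agrees c′ c′∉cs v with c ≟ c′
    ... | yes refl = refl
    ... | no c≢c′ = agrees c′ (λ { (here c′≡c) → c≢c′ (sym c′≡c) ; (there c′∈cs) → c′∉cs c′∈cs }) v

    forallWins-afterPainting : ∀ cs {g h} → (∀ c → c ∉ cs → g c ≗ E c) → ForallWins G H g h
    forallWins-afterPainting [] agrees = win (λ c → agrees c (λ ()))
    forallWins-afterPainting (c ∷ cs) agrees =
      play-G c (E c) (λ _ → forallWins-afterPainting cs (update-agrees agrees))

    forallWins-everywhere : ∀ g h → ForallWins G H g h
    forallWins-everywhere g h = forallWins-afterPainting (allFin k) (λ c c∉ → contradiction (∈-allFin c) c∉)

-- The argument does not need 2 ≤ n.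
lemma3p8 : (n : ℕ) → 2 ≤ n → (G H : Digraph n) → ¬ (G ≅ H) →
    ForallWinsGame ⌈log₂ n ⌉ G H
lemma3p8 n _ G H G≇H = forallWins-everywhere E finish empty empty
  where
  n≤2^k : n ≤ 2 ^ ⌈log₂ n ⌉
  n≤2^k = n≤2^⌈log₂n⌉ n

  E : Colouring ⌈log₂ n ⌉ n
  E = binaryColouring n≤2^k

  finish : ∀ {g h} → (∀ c → g c ≗ E c) → ForallWins G H g h
  finish g≗E = [ win-C1 , win-C2 ]′
    (separating⇒C1⊎C2 G≇H (separating-resp-≗ (λ c → sym ∘ g≗E c)
                                             (binaryColouring-separating n≤2^k)))
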